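{- If $G$ is a unicyclic graph of order $n$ whose unique cycle is $C_m$ with $3 \leq m < n$, then $e_{cc}(G) = m$.
   Context: A graph is unicyclic if it is connected and contains exactly one cycle. Cycle convexity: for $S\subseteq V(G)$, a vertex $v\notin S$ is in the cycle interval of $S$ if $G[S\cup\{v\}]$ contains a cycle through $v$; $S$ is cycle convex if no vertex outside $S$ is in its cycle interval; $\langle S\rangle_{cc}$ is the smallest cycle convex set containing $S$. A nonempty set $S\subseteq V(G)$ is $E$-independent if $|S|=1$ or there exist $p\in S$ and $p'\in \langle S\setminus\{p\}\rangle_{cc}\setminus \bigcup_{a\in S\setminus\{p\}}\langle S\setminus\{a\}\rangle_{cc}$. The exchange number $e_{cc}(G)$ is the maximum cardinality of an $E$-independent set of $G$. -}

module Defs where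

open import Data.Nat using (ℕ; suc; _≤_)
open import Data.Fin using (Fin; zero; suc; inject₁; fromℕ)
open import Data.Fin.Subset using (Subset; _∈_; _∉_; _⊆_; _─_; ⁅_⁆; ∣_∣; Nonempty; _∪_)
open import Data.Product using (Σ; ∃; ∃-syntax; _×_; _,_)
open import Data.Sum using (_⊎_)
open import Relation.Nullary using (¬_)
open import Relation.Binary.PropositionalEquality using (_≡_; _≢_)
open import Relation.Binary.Construct.Closure.ReflexiveTransitive using (Star)
open import Function.Definitions using (Injective)

record Graph (n : ℕ) : Set₁ where
  field
    Adj    : Fin n → Fin n → Set
    sym    : ∀ {u v} → Adj u v → Adj v u
    irrefl : ∀ {u} → ¬ Adj u u
open Graph public

Connected : ∀ {n} → Graph n → Set
Connected G = ∀ u v → Star (Adj G) u v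

-- A cycle of length (suc k) (k ≥ 2, i.e. length ≥ 3): distinct vertices
-- v₀ … v_k with v_i ~ v_{i+1} and v_k ~ v₀.
record Cycle {n : ℕ} (G : Graph n) : Set where
  field
    k      : ℕ
    k≥2    : 2 ≤ k
    vert   : Fin (suc k) → Fin n
    inj    : Injective _≡_ _≡_ vert
    step   : ∀ (i : Fin k) → Adj G (vert (inject₁ i)) (vert (suc i))
    close  : Adj G (vert (fromℕ k)) (vert zero)
open Cycle public

length : ∀ {n} {G : Graph n} → Cycle G → ℕ
length c = suc (k c)

Consec : ∀ {n} {G : Graph n} → Cycle G → Fin n → Fin n → Set
Consec c u v =
  (∃[ i ] (vert c (inject₁ i) ≡ u × vert c (suc i) ≡ v))
  ⊎ (vert c (fromℕ (k c)) ≡ u × vert c zero ≡ v)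

CycleEdge : ∀ {n} {G : Graph n} → Cycle G → Fin n → Fin n → Set
CycleEdge c u v = Consec c u v ⊎ Consec c v u

OnCycle : ∀ {n} {G : Graph n} → Cycle G → Fin n → Set
OnCycle c x = ∃[ i ] vert c i ≡ x

SameCycle : ∀ {n} {G : Graph n} → Cycle G → Cycle G → Set
SameCycle c d = ∀ u v → (CycleEdge c u v → CycleEdge d u v) × (CycleEdge d u v → CycleEdge c u v)

UnicyclicWith : ∀ {n} (G : Graph n) → Cycle G → Set
UnicyclicWith G c = Connected G × (∀ (d : Cycle G) → SameCycle c d)

-- cycle convexity
-- v ∉ S is in the cycle interval of S: G[S ∪ {v}] has a cycle through v
InCycleInterval : ∀ {n} (G : Graph n) → Subset n → Fin n → Set
InCycleInterval G S v =
  v ∉ S × (Σ (Cycle G) λ c → (OnCycle c v × (∀ x → OnCycle c x → x ∈ (S ∪ ⁅ v ⁆))))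

CycleConvex : ∀ {n} (G : Graph n) → Subset n → Set
CycleConvex G S = ∀ v → v ∉ S → ¬ InCycleInterval G S v

InHull : ∀ {n : ℕ} (G : Graph n) → Subset n → Fin n → Set
InHull {n} G S x = ∀ (T : Subset n) → S ⊆ T → CycleConvex G T → x ∈ T

EIndependent : ∀ {n} (G : Graph n) → Subset n → Set
EIndependent G S =
  Nonempty S ×
  (∣ S ∣ ≡ 1 ⊎
   (∃[ p ] ∃[ p' ] (p ∈ S × InHull G (S ─ ⁅ p ⁆) p'
     × (∀ a → a ∈ S → a ≢ p → ¬ InHull G (S ─ ⁅ a ⁆) p'))))

ExchangeNumber : ∀ {n} (G : Graph n) → ℕ → Set
ExchangeNumber G e =
  (∃[ S ] (EIndependent G S × ∣ S ∣ ≡ e))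
  × (∀ S → EIndependent G S → ∣ S ∣ ≤ e)

{-# OPTIONS --safe #-}
-- When C is the only cycle, a vertex set X is cycle convex unless it misses exactly one
-- vertex v of C, and then its hull is X ∪ {v}.  Replacing a vertex v₀ of C by a vertex w
-- off C (one exists since m < n) gives an E-independent set of size m, with p = w and
-- p' = v₀.  Conversely, if S is E-independent with |S| > 2 then p' ∉ S − p (a third element
-- a of S would keep p' in S − a), so S − p misses exactly one vertex v = p' of C; an element
-- a ∈ S − p off C would leave v in the hull of S − a, hence S − p ⊆ C − v and |S| ≤ m.
module Submission where

open import Defs
open import Data.Nat using (ℕ; _≤_; _<_; zero; suc; z≤n; s≤s; _≤?_)
open import Relation.Binary.PropositionalEquality
  using (_≡_; _≢_; refl; trans; cong; subst; module ≡-Reasoning) renaming (sym to ≡-sym)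
open import Data.Nat.Properties using (≤-trans; ≤-reflexive; m≤n⇒m≤1+n; ≰⇒>; <⇒≱; module ≤-Reasoning)
open import Data.Fin using (Fin; zero; suc)
open import Data.Fin.Properties using (_≟_; any?; injective⇒≤; suc-injective)
open import Data.Fin.Relation.Unary.Top using (view; ‵fromℕ; ‵inject₁)
open import Data.Fin.Subset using (Subset; _∈_; _∉_; _⊆_; _-_; ⁅_⁆; ∣_∣; _∪_; inside; outside; ⊥)
open import Data.Fin.Subset.Properties
  using (_∈?_; ∉⊥; x∈⁅x⁆; x∈⁅y⁆⇒x≡y; x∈p∪q⁻; x∈p∪q⁺; x∈p∧x≢y⇒x∈p-y; p─q⊆p;
         p⊆q⇒∣p∣≤∣q∣; ∣⁅x⁆∣≡1; ∣⊥∣≡0; ∣p∣≤∣x∷p∣; ∪-identityˡ; x∈p⇒∣p-x∣<∣p∣)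
open import Data.Vec using (_∷_; here; there)
open import Data.Product using (∃; _×_; _,_; proj₁; proj₂)
open import Data.Sum using (_⊎_; inj₁; inj₂; map₂)
open import Data.Empty using (⊥-elim)
open import Relation.Nullary using (¬_; Dec; yes; no)
open import Relation.Nullary.Decidable using (¬?; _×-dec_; decidable-stable)
open import Function using (_∘_; id)
open import Function.Definitions using (Injective)

image : ∀ {L n} → (Fin L → Fin n) → Subset n
image {zero}  f = ⊥
image {suc L} f = ⁅ f zero ⁆ ∪ image (f ∘ suc)

∈-image : ∀ {L n} (f : Fin L → Fin n) i → f i ∈ image f
∈-image {suc L} f zero    = x∈p∪q⁺ (inj₁ (x∈⁅x⁆ (f zero)))
∈-image {suc L} f (suc i) = x∈p∪q⁺ {p = ⁅ f zero ⁆} (inj₂ (∈-image (f ∘ suc) i))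

∈-image⁻ : ∀ {L n} (f : Fin L → Fin n) {x} → x ∈ image f → ∃ λ i → f i ≡ x
∈-image⁻ {zero}  f x∈ = ⊥-elim (∉⊥ x∈)
∈-image⁻ {suc L} f x∈ with x∈p∪q⁻ ⁅ f zero ⁆ (image (f ∘ suc)) x∈
... | inj₁ x∈⁅f0⁆ = zero , ≡-sym (x∈⁅y⁆⇒x≡y (f zero) x∈⁅f0⁆)
... | inj₂ x∈rest with ∈-image⁻ (f ∘ suc) x∈rest
...   | i , fi≡x = suc i , fi≡x

x∉p-x : ∀ {n} (p : Subset n) x → x ∉ p - x
x∉p-x (_ ∷ p) zero    ()
x∉p-x (_ ∷ p) (suc x) (there x∈) = x∉p-x p x x∈

∣⁅x⁆∪p∣≤1+∣p∣ : ∀ {n} (x : Fin n) (p : Subset n) → ∣ ⁅ x ⁆ ∪ p ∣ ≤ suc ∣ p ∣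
∣⁅x⁆∪p∣≤1+∣p∣ zero    (b ∷ p)       =
  s≤s (≤-trans (≤-reflexive (cong ∣_∣ (∪-identityˡ p))) (∣p∣≤∣x∷p∣ b p))
∣⁅x⁆∪p∣≤1+∣p∣ (suc x) (inside ∷ p)  = s≤s (∣⁅x⁆∪p∣≤1+∣p∣ x p)
∣⁅x⁆∪p∣≤1+∣p∣ (suc x) (outside ∷ p) = ∣⁅x⁆∪p∣≤1+∣p∣ x p

x∉p⇒∣⁅x⁆∪p∣≡1+∣p∣ : ∀ {n} {x : Fin n} {p : Subset n} → x ∉ p → ∣ ⁅ x ⁆ ∪ p ∣ ≡ suc ∣ p ∣
x∉p⇒∣⁅x⁆∪p∣≡1+∣p∣ {x = zero}  {inside ∷ p}  x∉ = ⊥-elim (x∉ here)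
x∉p⇒∣⁅x⁆∪p∣≡1+∣p∣ {x = zero}  {outside ∷ p} x∉ = cong (suc ∘ ∣_∣) (∪-identityˡ p)
x∉p⇒∣⁅x⁆∪p∣≡1+∣p∣ {x = suc x} {inside ∷ p}  x∉ = cong suc (x∉p⇒∣⁅x⁆∪p∣≡1+∣p∣ (x∉ ∘ there))
x∉p⇒∣⁅x⁆∪p∣≡1+∣p∣ {x = suc x} {outside ∷ p} x∉ = x∉p⇒∣⁅x⁆∪p∣≡1+∣p∣ (x∉ ∘ there)

∣image∣≡ : ∀ {L n} (f : Fin L → Fin n) → Injective _≡_ _≡_ f → ∣ image f ∣ ≡ L
∣image∣≡ {zero}  {n} f f-inj = ∣⊥∣≡0 n
∣image∣≡ {suc L}     f f-inj =
  trans (x∉p⇒∣⁅x⁆∪p∣≡1+∣p∣ f0∉) (cong suc (∣image∣≡ (f ∘ suc) (suc-injective ∘ f-inj)))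
  where
  f0∉ : f zero ∉ image (f ∘ suc)
  f0∉ f0∈ with ∈-image⁻ (f ∘ suc) f0∈
  ... | i , fi≡f0 with f-inj fi≡f0
  ...   | ()

∣⁅x⁆∪[p-y]∣≤∣p∣ : ∀ {n} (x : Fin n) {y} {p : Subset n} → y ∈ p →
                  ∣ ⁅ x ⁆ ∪ (p - y) ∣ ≤ ∣ p ∣
∣⁅x⁆∪[p-y]∣≤∣p∣ x {y} {p} y∈p = ≤-trans (∣⁅x⁆∪p∣≤1+∣p∣ x (p - y)) (x∈p⇒∣p-x∣<∣p∣ y∈p)

∃-third : ∀ {n} {S : Subset n} → 2 < ∣ S ∣ → ∀ x y → ∃ λ a → a ∈ S × a ≢ x × a ≢ y
∃-third {S = S} 2<∣S∣ x y with any? (λ a → (a ∈? S) ×-dec (¬? (a ≟ x) ×-dec ¬? (a ≟ y)))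
... | yes third = third
... | no ¬third = ⊥-elim (<⇒≱ 2<∣S∣ (≤-trans (p⊆q⇒∣p∣≤∣q∣ S⊆xy) ∣xy∣≤2))
  where
  S⊆xy : S ⊆ ⁅ x ⁆ ∪ ⁅ y ⁆
  S⊆xy {a} a∈S with a ≟ x | a ≟ y
  ... | yes refl | _      = x∈p∪q⁺ (inj₁ (x∈⁅x⁆ a))
  ... | no _     | yes refl = x∈p∪q⁺ {p = ⁅ x ⁆} (inj₂ (x∈⁅x⁆ a))
  ... | no a≢x   | no a≢y = ⊥-elim (¬third (a , a∈S , a≢x , a≢y))
  ∣xy∣≤2 : ∣ ⁅ x ⁆ ∪ ⁅ y ⁆ ∣ ≤ 2
  ∣xy∣≤2 = ≤-trans (∣⁅x⁆∪p∣≤1+∣p∣ x ⁅ y ⁆) (s≤s (≤-reflexive (∣⁅x⁆∣≡1 y)))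

module _ {n : ℕ} {G : Graph n} where

  ∈⇒InHull : ∀ {X x} → x ∈ X → InHull G X x
  ∈⇒InHull x∈X _ X⊆T _ = X⊆T x∈X

  InHull-convex : ∀ {X x} → CycleConvex G X → InHull G X x → x ∈ X
  InHull-convex X-convex x∈⟨X⟩ = x∈⟨X⟩ _ id X-convex

  exchange-∉ : ∀ {S p p'} → 2 < ∣ S ∣ → (∀ a → a ∈ S → a ≢ p → ¬ InHull G (S - a) p') →
               p' ∉ S - p
  exchange-∉ {S} {p} {p'} 2<∣S∣ p'∉⟨S-a⟩ p'∈S-p with ∃-third 2<∣S∣ p p'
  ... | a , a∈S , a≢p , a≢p' =
    p'∉⟨S-a⟩ a a∈S a≢p (∈⇒InHull (x∈p∧x≢y⇒x∈p-y (p─q⊆p S _ p'∈S-p) (a≢p' ∘ ≡-sym)))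

  InHull-closesCycle : (c : Cycle G) {X : Subset n} (i : Fin (length c)) →
                       (∀ j → j ≢ i → vert c j ∈ X) → InHull G X (vert c i)
  InHull-closesCycle c {X} i others∈X T X⊆T T-convex with vert c i ∈? T
  ... | yes ci∈T = ci∈T
  ... | no  ci∉T = ⊥-elim (T-convex (vert c i) ci∉T (ci∉T , c , (i , refl) , c⊆T+ci))
    where
    c⊆T+ci : ∀ x → OnCycle c x → x ∈ T ∪ ⁅ vert c i ⁆
    c⊆T+ci x (j , refl) with j ≟ i
    ... | yes refl = x∈p∪q⁺ {p = T} (inj₂ (x∈⁅x⁆ (vert c i)))
    ... | no  j≢i  = x∈p∪q⁺ (inj₁ (X⊆T (others∈X j j≢i)))

  onCycle? : (c : Cycle G) → ∀ x → Dec (OnCycle c x)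
  onCycle? c x = any? (λ i → vert c i ≟ x)

  ∃-offCycle : (c : Cycle G) → length c < n → ∃ λ w → ¬ OnCycle c w
  ∃-offCycle c c<n with any? (λ x → ¬? (onCycle? c x))
  ... | yes off = off
  ... | no ¬off = ⊥-elim (<⇒≱ c<n (injective⇒≤ position-injective))
    where
    position : ∀ x → OnCycle c x
    position x = decidable-stable (onCycle? c x) (¬off ∘ (x ,_))
    position-injective : Injective _≡_ _≡_ (proj₁ ∘ position)
    position-injective {x} {y} same = begin
      x                          ≡⟨ proj₂ (position x) ⟨
      vert c (proj₁ (position x)) ≡⟨ cong (vert c) same ⟩
      vert c (proj₁ (position y)) ≡⟨ proj₂ (position y) ⟩
      y                          ∎
      where open ≡-Reasoning

  consec⇒onCycle : (d : Cycle G) → ∀ {u v} → Consec d u v → OnCycle d u × OnCycle d v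
  consec⇒onCycle d (inj₁ (i , refl , refl)) = (_ , refl) , (_ , refl)
  consec⇒onCycle d (inj₂ (refl , refl))     = (_ , refl) , (_ , refl)

  cycleEdge⇒onCycle : (d : Cycle G) → ∀ {u v} → CycleEdge d u v → OnCycle d u
  cycleEdge⇒onCycle d (inj₁ uv) = proj₁ (consec⇒onCycle d uv)
  cycleEdge⇒onCycle d (inj₂ vu) = proj₂ (consec⇒onCycle d vu)

  consec-from : (d : Cycle G) (i : Fin (length d)) → ∃ λ v → Consec d (vert d i) v
  consec-from d i with view i
  ... | ‵fromℕ     = vert d zero , inj₂ (refl , refl)
  ... | ‵inject₁ j = vert d (suc j) , inj₁ (j , refl , refl)

  onCycle-⊆ : (d e : Cycle G) → (∀ u v → CycleEdge d u v → CycleEdge e u v) →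
              ∀ {x} → OnCycle d x → OnCycle e x
  onCycle-⊆ d e d⊆e (i , refl) with consec-from d i
  ... | v , dᵢv = cycleEdge⇒onCycle e (d⊆e _ v (inj₁ dᵢv))

module WithUniqueCycle {n : ℕ} {G : Graph n} (c : Cycle G) (unique : ∀ d → SameCycle c d) where

  private
    V : Fin (length c) → Fin n
    V = vert c

  onCycle-c⇒d : ∀ d {x} → OnCycle c x → OnCycle d x
  onCycle-c⇒d d = onCycle-⊆ c d (λ u v → proj₁ (unique d u v))

  onCycle-d⇒c : ∀ d {x} → OnCycle d x → OnCycle c x
  onCycle-d⇒c d = onCycle-⊆ d c (λ u v → proj₂ (unique d u v))

  ⊇cycle⇒convex : ∀ {X} → (∀ i → V i ∈ X) → CycleConvex G X
  ⊇cycle⇒convex {X} c⊆X u u∉X (_ , d , u∈d , _) with onCycle-d⇒c d u∈d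
  ... | i , refl = u∉X (c⊆X i)

  missesTwo⇒convex : ∀ {X i j} → i ≢ j → V i ∉ X → V j ∉ X → CycleConvex G X
  missesTwo⇒convex {X} {i} {j} i≢j Vi∉X Vj∉X u _ (_ , d , _ , d⊆X+u) =
    i≢j (inj c (trans (≡u Vi∉X (V∈d i)) (≡-sym (≡u Vj∉X (V∈d j)))))
    where
    V∈d : ∀ i → V i ∈ X ∪ ⁅ u ⁆
    V∈d i = d⊆X+u (V i) (onCycle-c⇒d d (i , refl))
    ≡u : ∀ {y} → y ∉ X → y ∈ X ∪ ⁅ u ⁆ → y ≡ u
    ≡u {y} y∉X y∈X+u with x∈p∪q⁻ X ⁅ u ⁆ y∈X+u
    ... | inj₁ y∈X = ⊥-elim (y∉X y∈X)
    ... | inj₂ y∈u = x∈⁅y⁆⇒x≡y u y∈u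

  nonconvex⇒missesOne : ∀ {X} → ¬ CycleConvex G X →
                        ∃ λ i → V i ∉ X × (∀ j → j ≢ i → V j ∈ X)
  nonconvex⇒missesOne {X} ¬convex with any? (λ i → ¬? (V i ∈? X))
  ... | no ¬missing =
    ⊥-elim (¬convex (⊇cycle⇒convex (λ i → decidable-stable (V i ∈? X) (¬missing ∘ (i ,_)))))
  ... | yes (i , Vi∉X) = i , Vi∉X , λ j j≢i →
    decidable-stable (V j ∈? X) (λ Vj∉X → ¬convex (missesTwo⇒convex j≢i Vj∉X Vi∉X))

  InHull-missesOne : ∀ {X i x} → (∀ j → j ≢ i → V j ∈ X) → InHull G X x → x ∈ X ⊎ x ≡ V i
  InHull-missesOne {X} {i} others∈X x∈⟨X⟩ =
    map₂ (x∈⁅y⁆⇒x≡y (V i))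
         (x∈p∪q⁻ X ⁅ V i ⁆ (x∈⟨X⟩ _ (x∈p∪q⁺ ∘ inj₁) (⊇cycle⇒convex X+Vi⊇c)))
    where
    X+Vi⊇c : ∀ j → V j ∈ X ∪ ⁅ V i ⁆
    X+Vi⊇c j with j ≟ i
    ... | yes refl = x∈p∪q⁺ {p = X} (inj₂ (x∈⁅x⁆ (V i)))
    ... | no  j≢i  = x∈p∪q⁺ (inj₁ (others∈X j j≢i))

  cycleWithV₀Replaced : Fin n → Subset n
  cycleWithV₀Replaced w = ⁅ w ⁆ ∪ image (V ∘ suc)

  module _ {w : Fin n} (w-off : ¬ OnCycle c w) where

    private
      S₀ : Subset n
      S₀ = cycleWithV₀Replaced w

    ∣cycleWithV₀Replaced∣ : ∣ S₀ ∣ ≡ length c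
    ∣cycleWithV₀Replaced∣ =
      trans (x∉p⇒∣⁅x⁆∪p∣≡1+∣p∣ w∉) (cong suc (∣image∣≡ (V ∘ suc) (suc-injective ∘ inj c)))
      where
      w∉ : w ∉ image (V ∘ suc)
      w∉ w∈ with ∈-image⁻ (V ∘ suc) w∈
      ... | i , Vi≡w = w-off (suc i , Vi≡w)

    V₀∉S₀ : V zero ∉ S₀
    V₀∉S₀ V₀∈ with x∈p∪q⁻ ⁅ w ⁆ _ V₀∈
    ... | inj₁ V₀∈w = w-off (zero , x∈⁅y⁆⇒x≡y w V₀∈w)
    ... | inj₂ V₀∈rest with ∈-image⁻ (V ∘ suc) V₀∈rest
    ...   | i , Vi≡V₀ with inj c Vi≡V₀
    ...     | ()

    V₀∈⟨S₀-w⟩ : InHull G (S₀ - w) (V zero)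
    V₀∈⟨S₀-w⟩ = InHull-closesCycle c zero others∈
      where
      others∈ : ∀ j → j ≢ zero → V j ∈ S₀ - w
      others∈ zero    j≢0 = ⊥-elim (j≢0 refl)
      others∈ (suc j) _   =
        x∈p∧x≢y⇒x∈p-y (x∈p∪q⁺ {p = ⁅ w ⁆} (inj₂ (∈-image (V ∘ suc) j))) (w-off ∘ (suc j ,_))

    V₀∉⟨S₀-a⟩ : ∀ a → a ∈ S₀ → a ≢ w → ¬ InHull G (S₀ - a) (V zero)
    V₀∉⟨S₀-a⟩ a a∈S₀ a≢w V₀∈⟨S₀-a⟩ with x∈p∪q⁻ ⁅ w ⁆ _ a∈S₀
    ... | inj₁ a∈w = a≢w (x∈⁅y⁆⇒x≡y w a∈w)
    ... | inj₂ a∈rest with ∈-image⁻ (V ∘ suc) a∈rest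
    ...   | i , refl = V₀∉S₀ (p─q⊆p S₀ _ (InHull-convex S₀-a-convex V₀∈⟨S₀-a⟩))
      where
      S₀-a-convex : CycleConvex G (S₀ - a)
      S₀-a-convex = missesTwo⇒convex (λ ()) (V₀∉S₀ ∘ p─q⊆p S₀ _) (x∉p-x S₀ a)

    cycleWithV₀Replaced-EIndependent : EIndependent G S₀
    cycleWithV₀Replaced-EIndependent =
      (w , w∈S₀) , inj₂ (w , V zero , w∈S₀ , V₀∈⟨S₀-w⟩ , V₀∉⟨S₀-a⟩)
      where
      w∈S₀ : w ∈ S₀
      w∈S₀ = x∈p∪q⁺ (inj₁ (x∈⁅x⁆ w))

  exchangeWitness⇒∣S∣≤length : ∀ {S p p'} → InHull G (S - p) p' → p' ∉ S - p →
                               (∀ a → a ∈ S → a ≢ p → ¬ InHull G (S - a) p') →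
                               ∣ S ∣ ≤ length c
  exchangeWitness⇒∣S∣≤length {S} {p} {p'} p'∈⟨S-p⟩ p'∉S-p p'∉⟨S-a⟩
    with nonconvex⇒missesOne (λ convex → p'∉S-p (InHull-convex convex p'∈⟨S-p⟩))
  ... | i , Vi∉S-p , others∈S-p = begin
    ∣ S ∣                        ≤⟨ p⊆q⇒∣p∣≤∣q∣ S⊆p+c-Vi ⟩
    ∣ ⁅ p ⁆ ∪ (image V - V i) ∣ ≤⟨ ∣⁅x⁆∪[p-y]∣≤∣p∣ p (∈-image V i) ⟩
    ∣ image V ∣                  ≡⟨ ∣image∣≡ V (inj c) ⟩
    length c                     ∎
    where
    open ≤-Reasoning
    p'≡Vi : p' ≡ V i
    p'≡Vi with InHull-missesOne others∈S-p p'∈⟨S-p⟩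
    ... | inj₁ p'∈S-p = ⊥-elim (p'∉S-p p'∈S-p)
    ... | inj₂ p'≡Vi  = p'≡Vi
    onCycle : ∀ {a} → a ∈ S → a ≢ p → OnCycle c a
    onCycle {a} a∈S a≢p = decidable-stable (onCycle? c a) λ a-off →
      p'∉⟨S-a⟩ a a∈S a≢p (subst (InHull G (S - a)) (≡-sym p'≡Vi) (InHull-closesCycle c i
        λ j j≢i → x∈p∧x≢y⇒x∈p-y (p─q⊆p S _ (others∈S-p j j≢i)) (a-off ∘ (j ,_))))
    S⊆p+c-Vi : S ⊆ ⁅ p ⁆ ∪ (image V - V i)
    S⊆p+c-Vi {x} x∈S with x ≟ p
    ... | yes refl = x∈p∪q⁺ (inj₁ (x∈⁅x⁆ x))
    ... | no  x≢p with onCycle x∈S x≢p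
    ...   | j , refl = x∈p∪q⁺ {p = ⁅ p ⁆} (inj₂ (x∈p∧x≢y⇒x∈p-y (∈-image V j) λ Vj≡Vi →
            Vi∉S-p (subst (_∈ S - p) Vj≡Vi (x∈p∧x≢y⇒x∈p-y x∈S x≢p))))

  EIndependent⇒∣S∣≤length : ∀ {S} → EIndependent G S → ∣ S ∣ ≤ length c
  EIndependent⇒∣S∣≤length (_ , inj₁ ∣S∣≡1) = ≤-trans (≤-reflexive ∣S∣≡1) (s≤s z≤n)
  EIndependent⇒∣S∣≤length {S} (_ , inj₂ (p , _ , _ , p'∈⟨S-p⟩ , p'∉⟨S-a⟩)) with ∣ S ∣ ≤? 2
  ... | yes ∣S∣≤2 = ≤-trans ∣S∣≤2 (m≤n⇒m≤1+n (k≥2 c))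
  ... | no  ∣S∣≰2 =
    exchangeWitness⇒∣S∣≤length p'∈⟨S-p⟩ (exchange-∉ (≰⇒> ∣S∣≰2) p'∉⟨S-a⟩) p'∉⟨S-a⟩

lemma4 : ∀ {n : ℕ} (G : Graph n) (c : Cycle G) (m : ℕ) →
         UnicyclicWith G c → length c ≡ m → 3 ≤ m → m < n →
         ExchangeNumber G m
lemma4 G c _ (_ , unique) refl _ m<n with ∃-offCycle c m<n
... | w , w-off =
  (cycleWithV₀Replaced w , cycleWithV₀Replaced-EIndependent w-off , ∣cycleWithV₀Replaced∣ w-off) ,
  λ _ → EIndependent⇒∣S∣≤length
  where open WithUniqueCycle c unique
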